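{- Let ${\sf V}$ be a quantale and $c:{\sf P}X\to{\sf V}^X$ a ${\sf V}$-valued closure space structure on a set $X$. Then $c$ is a ${\sf V}$-functor ${\sf P}X\to{\sf V}^X$, i.e. $[c_{\rm disc}B,c_{\rm disc}A]\le[cB,cA]$ for all $A,B\subseteq X$.
   Context: A quantale ${\sf V}=({\sf V},\otimes,{\sf k})$ is a complete lattice with a (not necessarily commutative) monoid structure $(\otimes,{\sf k})$ such that $\otimes$ preserves arbitrary suprema in each variable. A ${\sf V}$-valued closure space structure on $X$ is a map $c:{\sf P}X\to{\sf V}^X$ (${\sf P}X$ the power set, ${\sf V}^X$ the maps $X\to{\sf V}$) with (R) ${\sf k}\le (cA)(x)$ whenever $x\in A\subseteq X$, and (T) $\big(\bigwedge_{y\in B}(cA)(y)\big)\otimes (cB)(x)\le (cA)(x)$ for all $A,B\subseteq X$, $x\in X$. For $v,w\in{\sf V}$, $[v,w]$ is defined by $u\le[v,w]\iff u\otimes v\le w$; ${\sf V}^X$ is a ${\sf V}$-category with hom $[\sigma,\tau]=\bigwedge_{x\in X}[\sigma(x),\tau(x)]$. $c_{\rm disc}:{\sf P}X\to{\sf V}^X$ is $(c_{\rm disc}A)(x)={\sf k}$ if $x\in A$, $\bot$ otherwise, and ${\sf P}X$ is a ${\sf V}$-category with hom $\mathrm{hom}(A,B)=[c_{\rm disc}A,c_{\rm disc}B]$. A ${\sf V}$-functor $f:(X,a)\to(Y,b)$ between ${\sf V}$-categories is a map with $a(x,y)\le b(fx,fy)$. -}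

module Defs where

open import Level using (Level; _⊔_; suc)
open import Data.Product using (Σ; _,_)
open import Relation.Binary.PropositionalEquality using (_≡_)

record Quantale (c ℓ i : Level) : Set (suc (c ⊔ ℓ ⊔ i)) where
  infixr 7 _⊗_
  infix 4 _≤_
  field
    Carrier : Set c
    _≤_     : Carrier → Carrier → Set ℓ
    ≤-refl    : ∀ {x} → x ≤ x
    ≤-trans   : ∀ {x y z} → x ≤ y → y ≤ z → x ≤ z
    ≤-antisym : ∀ {x y} → x ≤ y → y ≤ x → x ≡ y
    ⋁ : {I : Set i} → (I → Carrier) → Carrier
    ⋁-upper : ∀ {I : Set i} (f : I → Carrier) (j : I) → f j ≤ ⋁ f
    ⋁-least : ∀ {I : Set i} (f : I → Carrier) (u : Carrier) →
              (∀ j → f j ≤ u) → ⋁ f ≤ u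
    ⋀ : {I : Set i} → (I → Carrier) → Carrier
    ⋀-lower : ∀ {I : Set i} (f : I → Carrier) (j : I) → ⋀ f ≤ f j
    ⋀-greatest : ∀ {I : Set i} (f : I → Carrier) (u : Carrier) →
                 (∀ j → u ≤ f j) → u ≤ ⋀ f
    _⊗_ : Carrier → Carrier → Carrier
    k   : Carrier
    ⊗-assoc : ∀ x y z → (x ⊗ y) ⊗ z ≡ x ⊗ (y ⊗ z)
    ⊗-identityˡ : ∀ x → k ⊗ x ≡ x
    ⊗-identityʳ : ∀ x → x ⊗ k ≡ x
    ⊗-⋁ˡ : ∀ {I : Set i} (f : I → Carrier) (v : Carrier) →
           (⋁ f) ⊗ v ≡ ⋁ (λ j → f j ⊗ v)
    ⊗-⋁ʳ : ∀ {I : Set i} (v : Carrier) (f : I → Carrier) →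
           v ⊗ (⋁ f) ≡ ⋁ (λ j → v ⊗ f j)
    [_,_] : Carrier → Carrier → Carrier
    hom-intro : ∀ {u v w} → u ⊗ v ≤ w → u ≤ [ v , w ]
    hom-elim  : ∀ {u v w} → u ≤ [ v , w ] → u ⊗ v ≤ w

module _ {c ℓ i : Level} (V : Quantale c ℓ i) where
  open Quantale V

  𝒫 : Set i → Set (suc i)
  𝒫 X = X → Set i

  homᵛ : {X : Set i} → (X → Carrier) → (X → Carrier) → Carrier
  homᵛ σ τ = ⋀ (λ x → [ σ x , τ x ])

  -- c_disc A x = k if x ∈ A, ⊥ otherwise; written constructively as the
  -- supremum of k over the proofs of x ∈ A (classically the same thing).
  c-disc : {X : Set i} → 𝒫 X → X → Carrier
  c-disc A x = ⋁ {I = A x} (λ _ → k)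

  hom𝒫 : {X : Set i} → 𝒫 X → 𝒫 X → Carrier
  hom𝒫 A B = homᵛ (c-disc A) (c-disc B)

  record ClosureSpace (X : Set i) : Set (c ⊔ ℓ ⊔ suc i) where
    field
      cl  : 𝒫 X → X → Carrier
      cl-R : ∀ (A : 𝒫 X) (x : X) → A x → k ≤ cl A x
      cl-T : ∀ (A B : 𝒫 X) (x : X) →
             (⋀ {I = Σ X B} (λ { (y , _) → cl A y })) ⊗ cl B x ≤ cl A x

-- An inclusion-grade u ≤ [c_disc B, c_disc A] forces u ≤ (cA)(y) for every
-- y ∈ B, by reflexivity (R) of c applied to A.  Hence u ≤ ⋀_{y∈B} (cA)(y), and
-- transitivity (T) turns u ⊗ (cB)(x) into a lower bound of (cA)(x), which is
-- exactly u ≤ [cB, cA].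
module Submission where

open import Defs
open import Level using (Level)
open import Data.Product using (_,_)
open import Relation.Binary.PropositionalEquality using (subst; sym)

module QuantaleProperties {c ℓ i : Level} (V : Quantale c ℓ i) where
  open Quantale V

  ⊗-monoˡ-≤ : ∀ {a b v} → a ≤ b → a ⊗ v ≤ b ⊗ v
  ⊗-monoˡ-≤ a≤b = hom-elim (≤-trans a≤b (hom-intro ≤-refl))

  homᵛ-intro : ∀ {X : Set i} {u} {σ τ : X → Carrier} →
               (∀ x → u ⊗ σ x ≤ τ x) → u ≤ homᵛ V σ τ
  homᵛ-intro u⊗σ≤τ = ⋀-greatest _ _ λ x → hom-intro (u⊗σ≤τ x)

  homᵛ-elim : ∀ {X : Set i} {u} {σ τ : X → Carrier} →
              u ≤ homᵛ V σ τ → ∀ x → u ⊗ σ x ≤ τ x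
  homᵛ-elim u≤hom x = hom-elim (≤-trans u≤hom (⋀-lower _ x))

  ≤-⊗-c-disc : ∀ {X : Set i} (A : 𝒫 V X) {x} u → A x → u ≤ u ⊗ c-disc V A x
  ≤-⊗-c-disc A {x} u x∈A =
    subst (_≤ u ⊗ c-disc V A x) (⊗-identityʳ u)
      (subst (u ⊗ k ≤_) (sym (⊗-⋁ʳ u (λ _ → k))) (⋁-upper (λ _ → u ⊗ k) x∈A))

  c-disc-least : ∀ {X : Set i} (A : 𝒫 V X) (σ : X → Carrier) →
                 (∀ x → A x → k ≤ σ x) → ∀ x → c-disc V A x ≤ σ x
  c-disc-least A σ k≤σ x = ⋁-least _ _ (k≤σ x)

  hom𝒫-≤-above-k : ∀ {X : Set i} (A B : 𝒫 V X) (σ : X → Carrier) →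
                   (∀ x → A x → k ≤ σ x) → ∀ y → B y → hom𝒫 V B A ≤ σ y
  hom𝒫-≤-above-k A B σ k≤σ y y∈B =
    ≤-trans (≤-⊗-c-disc B _ y∈B)
      (≤-trans (homᵛ-elim ≤-refl y) (c-disc-least A σ k≤σ y))

module ClosureSpaceProperties {c ℓ i : Level} (V : Quantale c ℓ i)
                              {X : Set i} (C : ClosureSpace V X) where
  open Quantale V
  open QuantaleProperties V
  open ClosureSpace C

  cl-⊗-≤ : ∀ (A B : 𝒫 V X) {u} → (∀ y → B y → u ≤ cl A y) →
           ∀ x → u ⊗ cl B x ≤ cl A x
  cl-⊗-≤ A B u≤clA x =
    ≤-trans (⊗-monoˡ-≤ (⋀-greatest _ _ λ { (y , y∈B) → u≤clA y y∈B }))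
            (cl-T A B x)

  hom𝒫-≤-cl : ∀ (A B : 𝒫 V X) y → B y → hom𝒫 V B A ≤ cl A y
  hom𝒫-≤-cl A B = hom𝒫-≤-above-k A B (cl A) (cl-R A)

corollary5p2 : ∀ {c ℓ i : Level} (V : Quantale c ℓ i) {X : Set i}
    (C : ClosureSpace V X) (A B : 𝒫 V X) →
    Quantale._≤_ V (hom𝒫 V B A)
    (homᵛ V (ClosureSpace.cl C B) (ClosureSpace.cl C A))
corollary5p2 V C A B = homᵛ-intro (cl-⊗-≤ A B (hom𝒫-≤-cl A B))
  where
  open QuantaleProperties V
  open ClosureSpaceProperties V C
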